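{- (Modus ponens.) Let $\otimes$ be a merge, $r,r'$ interactive realizers, $A,B$ formulas of $\mathcal{L}_1$ with free variables among $x_1,\ldots,x_k$, and $\vec\alpha\in(\mathcal{S}\mathbb{N})^k$. If $r\Vdash\vec\alpha:A$ and $r'\Vdash\vec\alpha:A\rightarrow B$, then $r\otimes^{\mathcal{S}}r'\Vdash\vec\alpha:B$.
   Context: $\mathcal{L}_1$: quantifier-free language of primitive recursive arithmetic extended with symbols $\varphi_P$ (function) and $\chi_P$ (predicate) for each primitive recursive predicate symbol $P$. A state is a finite set $s$ of triples $\langle P,\vec m,n\rangle$ with $P(\vec m,n)$ true in the standard model and at most one $n$ per $(P,\vec m)$; $\mathbb{S}$ the set of states, ordered by inclusion $\sqsubseteq$, $\bot=\emptyset$; compatible states have a state as union. $\mathcal{S}X=\mathbb{S}\to X$. Each formula $A$ and environment $\xi:\mathrm{Var}\to\mathcal{S}\mathbb{N}$ determine $[\![A]\!]_\xi\in\mathcal{S}\mathrm{Bool}$ ($\mathcal{L}_0$-symbols pointwise with standard meaning; $\varphi_P(\vec t)$ at $s$ is the $n$ with $\langle P,[\![\vec t]\!]_\xi(s),n\rangle\in s$ or $0$; $\chi_P(\vec t)$ at $s$ is true iff such $n$ exists; connectives pointwise boolean). A merge is $\otimes:\mathbb{S}\times\mathbb{S}\to\mathbb{S}$ making $(\mathbb{S},\otimes,\bot)$ a monoid, with $s_1\otimes s_2=\bot\Rightarrow s_1=s_2=\bot$ and $s_1\otimes s_2\subseteq s_1\cup s_2$; $(r\otimes^{\mathcal{S}}r')(s)=r(s)\otimes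 r'(s)$. An interactive realizer is $r:\mathbb{S}\to\mathbb{S}$, strongly convergent (for every $\sigma:\mathbb{N}\to\mathbb{S}$ with $\sigma(i)\sqsubseteq\sigma(j)$ for $i\le j$, $r(\sigma(i))$ is eventually constant), with $r(s)$ compatible with $s$ and $r(s)\cap s=\emptyset$; $\mathrm{Prefix}(r)=\{s\mid r(s)\sqsubseteq s\}$. $r\Vdash\vec\alpha:A$ means $[\![A]\!]_{[\lambda\_.\alpha_i(s)/x_i]}(s)=\mathsf{true}$ for all $s\in\mathrm{Prefix}(r)$. -}

module Defs where

open import Data.Nat using (ℕ; zero; suc; _≤_; _≟_)
open import Data.Nat.Properties using () renaming (_≟_ to _≟ℕ_)
open import Data.Fin using (Fin)
open import Data.Fin.Properties using () renaming (_≟_ to _≟F_)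
open import Data.Vec using (Vec; []; _∷_; _∷ʳ_; lookup)
open import Data.Vec.Properties using () renaming (≡-dec to ≡-decVec)
open import Data.List using (List; []; _∷_; _++_)
open import Data.List.Membership.Propositional using (_∈_)
open import Data.List.Relation.Unary.All using (All)
open import Data.Bool using (Bool; true; false; not; _∧_; _∨_)
open import Data.Maybe using (Maybe; just; nothing)
open import Data.Product using (Σ; ∃; _×_; _,_; proj₁; proj₂)
open import Data.Product.Properties using () renaming (≡-dec to ≡-decΣ)
open import Data.Sum using (_⊎_)
open import Data.Empty using (⊥)
open import Relation.Nullary using (¬_; Dec; yes; no; does)
open import Relation.Binary.PropositionalEquality using (_≡_; refl; cong)
open import Relation.Binary.Definitions using (DecidableEquality)

-- Syntax of primitive recursive functions (function symbols of L0).
-- A primitive recursive predicate symbol of arity n is a primitive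
-- recursive term of arity n (its characteristic function); the
-- predicate holds at a tuple iff the value is nonzero.

data PR : ℕ → Set where
  Zero : PR 0
  Succ : PR 1
  Proj : ∀ {n} → Fin n → PR n
  Comp : ∀ {k n} → PR k → Vec (PR n) k → PR n
  Rec  : ∀ {n} → PR n → PR (suc (suc n)) → PR (suc n)

mutual
  evalPR : ∀ {n} → PR n → Vec ℕ n → ℕ
  evalPR Zero []          = 0
  evalPR Succ (x ∷ [])    = suc x
  evalPR (Proj i) xs      = lookup xs i
  evalPR (Comp f gs) xs   = evalPR f (evalPRs gs xs)
  evalPR (Rec g h) (zero ∷ xs)  = evalPR g xs
  evalPR (Rec g h) (suc y ∷ xs) = evalPR h (evalPR (Rec g h) (y ∷ xs) ∷ y ∷ xs)

  evalPRs : ∀ {k n} → Vec (PR n) k → Vec ℕ n → Vec ℕ k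
  evalPRs [] xs       = []
  evalPRs (g ∷ gs) xs = evalPR g xs ∷ evalPRs gs xs

Holds : ∀ {n} → PR n → Vec ℕ n → Set
Holds P xs = ¬ (evalPR P xs ≡ 0)

holds? : ∀ {n} → PR n → Vec ℕ n → Bool
holds? P xs = not (does (evalPR P xs ≟ℕ 0))

mutual
  decPR : ∀ {n} → DecidableEquality (PR n)
  decPR Zero Zero = yes refl
  decPR Zero (Proj _) = no λ ()
  decPR Zero (Comp _ _) = no λ ()
  decPR Succ Succ = yes refl
  decPR Succ (Proj _) = no λ ()
  decPR Succ (Comp _ _) = no λ ()
  decPR Succ (Rec _ _) = no λ ()
  decPR (Proj i) Zero = no λ ()
  decPR (Proj i) Succ = no λ ()
  decPR (Proj i) (Proj j) with i ≟F j
  ... | yes refl = yes refl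
  ... | no ne = no λ { refl → ne refl }
  decPR (Proj i) (Comp _ _) = no λ ()
  decPR (Proj i) (Rec _ _) = no λ ()
  decPR (Comp _ _) Zero = no λ ()
  decPR (Comp _ _) Succ = no λ ()
  decPR (Comp _ _) (Proj _) = no λ ()
  decPR (Comp {k} f gs) (Comp {k'} f' gs') with k ≟ℕ k'
  ... | no ne = no λ { refl → ne refl }
  ... | yes refl with decPR f f' | decPRs gs gs'
  ...   | yes refl | yes refl = yes refl
  ...   | no ne | _ = no λ { refl → ne refl }
  ...   | yes _ | no ne = no λ { refl → ne refl }
  decPR (Comp _ _) (Rec _ _) = no λ ()
  decPR (Rec _ _) Succ = no λ ()
  decPR (Rec _ _) (Proj _) = no λ ()
  decPR (Rec _ _) (Comp _ _) = no λ ()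
  decPR (Rec g h) (Rec g' h') with decPR g g' | decPR h h'
  ... | yes refl | yes refl = yes refl
  ... | no ne | _ = no λ { refl → ne refl }
  ... | yes _ | no ne = no λ { refl → ne refl }

  decPRs : ∀ {k n} → DecidableEquality (Vec (PR n) k)
  decPRs [] [] = yes refl
  decPRs (g ∷ gs) (g' ∷ gs') with decPR g g' | decPRs gs gs'
  ... | yes refl | yes refl = yes refl
  ... | no ne | _ = no λ { refl → ne refl }
  ... | yes _ | no ne = no λ { refl → ne refl }

Triple : Set
Triple = Σ ℕ λ k → PR (suc k) × Vec ℕ k × ℕ

decTriple : DecidableEquality Triple
decTriple = ≡-decΣ _≟ℕ_ (≡-decΣ decPR (≡-decΣ (≡-decVec _≟ℕ_) _≟ℕ_))

ValidTriple : Triple → Set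
ValidTriple (k , P , ms , n) = Holds P (ms ∷ʳ n)

-- a finite set of triples, represented by a list (equality of states is
-- the set equality _≈_ below)
Functional : List Triple → Set
Functional xs = ∀ k (P : PR (suc k)) (ms : Vec ℕ k) n n' →
  (k , P , ms , n) ∈ xs → (k , P , ms , n') ∈ xs → n ≡ n'

record State : Set where
  constructor state
  field
    elems : List Triple
    valid : All ValidTriple elems
    functional : Functional elems
open State public

_∈S_ : Triple → State → Set
x ∈S s = x ∈ elems s

_⊑_ : State → State → Set
s ⊑ s' = ∀ x → x ∈S s → x ∈S s'

_≈_ : State → State → Set
s ≈ s' = (s ⊑ s') × (s' ⊑ s)

⊥S : State
⊥S = state [] All.[] (λ _ _ _ _ _ ())

-- union (as a list) and compatibility: the union is again a state
Compatible : State → State → Set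
Compatible s s' = Functional (elems s ++ elems s')

_⊑∪_ : State → State × State → Set
s ⊑∪ (s₁ , s₂) = ∀ x → x ∈S s → x ∈S s₁ ⊎ x ∈S s₂

𝒮 : Set → Set
𝒮 X = State → X

-- maps on states (and 𝒮-values) are required to be well defined on
-- states as sets, i.e. to respect _≈_
RespectsS : {X : Set} → 𝒮 X → Set
RespectsS f = ∀ {s s'} → s ≈ s' → f s ≡ f s'

record Merge : Set where
  field
    _⊗_ : State → State → State
    ⊗-cong : ∀ {s₁ s₁' s₂ s₂'} → s₁ ≈ s₁' → s₂ ≈ s₂' → (s₁ ⊗ s₂) ≈ (s₁' ⊗ s₂')
    ⊗-assoc : ∀ s₁ s₂ s₃ → ((s₁ ⊗ s₂) ⊗ s₃) ≈ (s₁ ⊗ (s₂ ⊗ s₃))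
    ⊗-identityˡ : ∀ s → (⊥S ⊗ s) ≈ s
    ⊗-identityʳ : ∀ s → (s ⊗ ⊥S) ≈ s
    ⊗-zeroSum : ∀ s₁ s₂ → (s₁ ⊗ s₂) ≈ ⊥S → (s₁ ≈ ⊥S) × (s₂ ≈ ⊥S)
    ⊗-⊆∪ : ∀ s₁ s₂ → (s₁ ⊗ s₂) ⊑∪ (s₁ , s₂)

_⊗[_]𝒮_ : 𝒮 State → Merge → 𝒮 State → 𝒮 State
(r ⊗[ M ]𝒮 r') s = Merge._⊗_ M (r s) (r' s)

Monotone : (ℕ → State) → Set
Monotone σ = ∀ i j → i ≤ j → σ i ⊑ σ j

StronglyConvergent : (State → State) → Set
StronglyConvergent r = ∀ (σ : ℕ → State) → Monotone σ →
  ∃ λ N → ∀ i → N ≤ i → r (σ i) ≈ r (σ N)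

record InteractiveRealizer : Set where
  field
    realize : State → State
    respects : ∀ {s s'} → s ≈ s' → realize s ≈ realize s'
    stronglyConvergent : StronglyConvergent realize
    compatible : ∀ s → Compatible (realize s) s
    disjoint : ∀ s x → x ∈S realize s → x ∈S s → ⊥
open InteractiveRealizer public

Prefix : (State → State) → State → Set
Prefix r s = r s ⊑ s

-- The language L1 with free variables among x₁ … x_k (as Fin k)

data Term (k : ℕ) : Set where
  var : Fin k → Term k
  fun : ∀ {n} → PR n → Vec (Term k) n → Term k
  φ   : ∀ {n} → PR (suc n) → Vec (Term k) n → Term k

data Formula (k : ℕ) : Set where
  _≐_  : Term k → Term k → Formula k
  pred : ∀ {n} → PR n → Vec (Term k) n → Formula k
  χ    : ∀ {n} → PR (suc n) → Vec (Term k) n → Formula k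
  ⊥f ⊤f : Formula k
  ¬f_  : Formula k → Formula k
  _∧f_ _∨f_ _⇒_ : Formula k → Formula k → Formula k

lookupS : List Triple → ∀ {n} → PR (suc n) → Vec ℕ n → Maybe ℕ
lookupS [] P ms = nothing
lookupS ((k , Q , ms' , v) ∷ xs) {n} P ms with k ≟ℕ n
... | no _ = lookupS xs P ms
... | yes refl with decPR Q P | ≡-decVec _≟ℕ_ ms' ms
...   | yes _ | yes _ = just v
...   | _ | _ = lookupS xs P ms

mutual
  ⟦_⟧t : ∀ {k} → Term k → (Fin k → 𝒮 ℕ) → 𝒮 ℕ
  ⟦ var i ⟧t ξ s = ξ i s
  ⟦ fun f ts ⟧t ξ s = evalPR f (⟦ ts ⟧ts ξ s)
  ⟦ φ P ts ⟧t ξ s with lookupS (elems s) P (⟦ ts ⟧ts ξ s)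
  ... | just v = v
  ... | nothing = 0

  ⟦_⟧ts : ∀ {k n} → Vec (Term k) n → (Fin k → 𝒮 ℕ) → 𝒮 (Vec ℕ n)
  ⟦ [] ⟧ts ξ s = []
  ⟦ t ∷ ts ⟧ts ξ s = ⟦ t ⟧t ξ s ∷ ⟦ ts ⟧ts ξ s

⟦_⟧ : ∀ {k} → Formula k → (Fin k → 𝒮 ℕ) → 𝒮 Bool
⟦ t ≐ u ⟧ ξ s = does (⟦ t ⟧t ξ s ≟ℕ ⟦ u ⟧t ξ s)
⟦ pred P ts ⟧ ξ s = holds? P (⟦ ts ⟧ts ξ s)
⟦ χ P ts ⟧ ξ s with lookupS (elems s) P (⟦ ts ⟧ts ξ s)
... | just _ = true
... | nothing = false
⟦ ⊥f ⟧ ξ s = false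
⟦ ⊤f ⟧ ξ s = true
⟦ ¬f A ⟧ ξ s = not (⟦ A ⟧ ξ s)
⟦ A ∧f B ⟧ ξ s = ⟦ A ⟧ ξ s ∧ ⟦ B ⟧ ξ s
⟦ A ∨f B ⟧ ξ s = ⟦ A ⟧ ξ s ∨ ⟦ B ⟧ ξ s
⟦ A ⇒ B ⟧ ξ s = not (⟦ A ⟧ ξ s) ∨ ⟦ B ⟧ ξ s

_⊩_∶_ : ∀ {k} → (State → State) → (Fin k → 𝒮 ℕ) → Formula k → Set
r ⊩ α ∶ A = ∀ s → Prefix r s → ⟦ A ⟧ (λ i _ → α i s) s ≡ true

module Submission where

-- Fix a state s in Prefix(r ⊗^𝒮 r'), i.e. r(s) ⊗ r'(s) ⊑ s.  Every triple
-- of the merge lies in r(s) or in r'(s), and both are disjoint from s;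
-- hence a merge of two outputs that is contained in s must be empty.
-- By zero-sum freeness of the merge monoid, r(s) and r'(s) are then empty,
-- so s is a prefix of r and of r' alike.  At such an s both hypotheses
-- hold: ⟦A⟧ and ⟦A → B⟧ are true, and boolean modus ponens gives ⟦B⟧.

open import Defs
open import Data.Nat using (ℕ)
open import Data.Fin using (Fin)
open import Data.Bool using (true; not; _∨_)
open import Data.Sum using (inj₁; inj₂)
open import Data.Product using (_×_; _,_; proj₁; proj₂)
open import Data.Empty using (⊥; ⊥-elim)
open import Relation.Binary.PropositionalEquality using (_≡_; refl)

≈⊥S⇒⊑ : ∀ t → t ≈ ⊥S → ∀ s → t ⊑ s
≈⊥S⇒⊑ t t≈⊥ s x x∈t with proj₁ t≈⊥ x x∈t
... | ()

merge-below-disjoint-empty : (M : Merge) (s t₁ t₂ : State) →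
  (∀ x → x ∈S t₁ → x ∈S s → ⊥) → (∀ x → x ∈S t₂ → x ∈S s → ⊥) →
  Merge._⊗_ M t₁ t₂ ⊑ s → Merge._⊗_ M t₁ t₂ ≈ ⊥S
merge-below-disjoint-empty M s t₁ t₂ t₁#s t₂#s below = ⊑⊥ , (λ _ ())
  where
  open Merge M
  ⊑⊥ : (t₁ ⊗ t₂) ⊑ ⊥S
  ⊑⊥ x x∈ with ⊗-⊆∪ t₁ t₂ x x∈
  ... | inj₁ x∈t₁ = ⊥-elim (t₁#s x x∈t₁ (below x x∈))
  ... | inj₂ x∈t₂ = ⊥-elim (t₂#s x x∈t₂ (below x x∈))

-- A prefix of the merge of two interactive realizers is a prefix of each:
-- the merged output is empty there, hence so are both outputs.
prefix-merge : (M : Merge) (r r' : InteractiveRealizer) (s : State) →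
  Prefix (realize r ⊗[ M ]𝒮 realize r') s →
  Prefix (realize r) s × Prefix (realize r') s
prefix-merge M r r' s pre =
  ≈⊥S⇒⊑ (realize r s) (proj₁ both-empty) s
  , ≈⊥S⇒⊑ (realize r' s) (proj₂ both-empty) s
  where
  open Merge M
  both-empty : (realize r s ≈ ⊥S) × (realize r' s ≈ ⊥S)
  both-empty = ⊗-zeroSum (realize r s) (realize r' s)
    (merge-below-disjoint-empty M s (realize r s) (realize r' s)
      (disjoint r s) (disjoint r' s) pre)

-- Modus ponens for booleans, matching the clause ⟦A ⇒ B⟧ = not ⟦A⟧ ∨ ⟦B⟧.
bool-modus-ponens : ∀ a b → a ≡ true → not a ∨ b ≡ true → b ≡ true
bool-modus-ponens true b refl a⇒b = a⇒b

lemma6p12 : (M : Merge) (r r' : InteractiveRealizer) {k : ℕ} (A B : Formula k)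
    (α : Fin k → 𝒮 ℕ) → (∀ i → RespectsS (α i)) →
    realize r ⊩ α ∶ A → realize r' ⊩ α ∶ (A ⇒ B) →
    (realize r ⊗[ M ]𝒮 realize r') ⊩ α ∶ B
lemma6p12 M r r' A B α _ r⊩A r'⊩A⇒B s pre =
  bool-modus-ponens (⟦ A ⟧ ξ s) (⟦ B ⟧ ξ s) (r⊩A s pre-r) (r'⊩A⇒B s pre-r')
  where
  ξ : Fin _ → 𝒮 ℕ
  ξ i _ = α i s
  pre-r : Prefix (realize r) s
  pre-r = proj₁ (prefix-merge M r r' s pre)
  pre-r' : Prefix (realize r') s
  pre-r' = proj₂ (prefix-merge M r r' s pre)
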